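{- Let $K$ be a field and $q\in K^\times$ with $q^N\neq1$ for all integers $N\geq1$. Let $k\geq0$, $0\leq h\leq k$, let $a_0,a_{k+1}\in K^\times$ and $a_1,\dots,a_k\in K$, and assume $a_h\neq a_{h+1}$. Assume all the iterated $q$-integral symbols below are defined. Then \[ I_q(a_0;a_1,\dots,a_k;a_{k+1})-I_q(a_0;a_1,\dots,a_h,a_{h+1}q,\dots,a_kq;a_{k+1}q)=S_1+S_2, \] where $S_1=\dfrac{a_hI_q(a_0;a_1,\dots,\widehat{a_{h+1}},\dots,a_k;a_{k+1})}{a_h-a_{h+1}}$ if $h<k$ and $S_1=0$ if $h=k$, and $S_2=\dfrac{a_{h+1}I_q(a_0;a_1,\dots,\widehat{a_h},\dots,a_k;a_{k+1})}{a_{h+1}-a_h}$ if $h>0$ and $S_2=0$ if $h=0$. (Here $\widehat{\ }$ denotes omission of that entry, and in the second symbol on the left exactly the entries $a_{h+1},\dots,a_k$ and the upper endpoint are multiplied by $q$.)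
   Context: Define a partial order on $K^\times$ by $x\trianglelefteq y$ iff $y/x\in\{q^{ -n}\mid n\in\mathbb{Z}_{\geq0}\}$. For $x,y\in K^\times$ with $x\trianglelefteq y$ and $u_1,\dots,u_k\in K$ such that no $t$ with $x\trianglelefteq t\trianglelefteq y$ equals any $u_j$, set \[ I_q(x;u_1,\dots,u_k;y):=\sum_{x\trianglelefteq t_1\trianglelefteq\cdots\trianglelefteq t_k\trianglelefteq y}\prod_{j=1}^k\frac{t_j}{t_j-u_j} \] (equal to $1$ when $k=0$). A symbol is "defined" when these conditions hold. -}

module Defs where

open import Level using (Level; _⊔_)
open import Algebra.Bundles using (CommutativeRing)
open import Data.Nat as ℕ using (ℕ; zero; suc; _∸_; _≟_; _≤ᵇ_)
open import Data.List using (List; []; _∷_; map; upTo; filter; foldr)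
open import Data.List.Relation.Unary.All using (All)
open import Data.Product using (Σ; _×_; proj₁)
open import Data.Bool using (if_then_else_)
open import Relation.Nullary using (¬_)
open import Relation.Nullary.Decidable using (¬?)

-- The inverse is a total function `inv`
-- (its value at 0 is irrelevant/unspecified), congruent w.r.t. ≈.
record Field (c ℓ : Level) : Set (Level.suc (c ⊔ ℓ)) where
  field
    commutativeRing : CommutativeRing c ℓ
  open CommutativeRing commutativeRing public
  field
    inv      : Carrier → Carrier
    inv-cong : ∀ {x y} → x ≈ y → inv x ≈ inv y
    inverse  : ∀ x → ¬ (x ≈ 0#) → x * inv x ≈ 1#
    0≉1      : ¬ (0# ≈ 1#)

module FieldDefs {c ℓ : Level} (F : Field c ℓ) where
  open Field F

  pow : Carrier → ℕ → Carrier
  pow x zero    = 1#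
  pow x (suc n) = pow x n * x

  _÷_ : Carrier → Carrier → Carrier
  x ÷ y = x * inv y

  module _ (q : Carrier) where

    _⊴_ : Carrier → Carrier → Set ℓ
    x ⊴ y = Σ ℕ λ n → y ≈ x * pow (inv q) n

    sumK : List Carrier → Carrier
    sumK = foldr _+_ 0#

    range : ℕ → ℕ → List ℕ
    range lo n = map (lo ℕ.+_) (upTo (suc (n ∸ lo)))

    -- chain x us lo n = Σ_{lo ≤ m₁ ≤ … ≤ m_k ≤ n} Π_j t_j/(t_j - u_j),
    -- where t_j = x · (q⁻¹)^{m_j}
    chain : Carrier → List Carrier → ℕ → ℕ → Carrier
    chain x []       lo n = 1#
    chain x (u ∷ us) lo n =
      sumK (map (λ m → let t = x * pow (inv q) m in
                        (t ÷ (t - u)) * chain x us m n)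
                (range lo n))

    -- I_q(x; u₁,…,u_k; y), given a witness of x ⊴ y
    -- (the exponent n with y = x q^{-n} is unique when q is not a root of unity)
    Iq : (x : Carrier) → List Carrier → (y : Carrier) → x ⊴ y → Carrier
    Iq x us y p = chain x us 0 (proj₁ p)

    Defined : Carrier → List Carrier → Carrier → Set (c ⊔ ℓ)
    Defined x us y =
      ¬ (x ≈ 0#) × ¬ (y ≈ 0#) ×
      Σ (x ⊴ y) λ _ →
        ∀ t → x ⊴ t → t ⊴ y → All (λ u → ¬ (t ≈ u)) us

  idx : ℕ → List ℕ
  idx k = map suc (upTo k)

  entries : (ℕ → Carrier) → ℕ → List Carrier
  entries a k = map a (idx k)

  shifted : Carrier → (ℕ → Carrier) → ℕ → ℕ → List Carrier
  shifted q a k h = map (λ j → if j ≤ᵇ h then a j else a j * q) (idx k)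

  omit : (ℕ → Carrier) → ℕ → ℕ → List Carrier
  omit a k j = map a (filter (λ i → ¬? (i ≟ j)) (idx k))

{-# OPTIONS --safe #-}
module Submission where

-- Write tₘ = a₀ q⁻ᵐ and f_u(m) = tₘ / (tₘ - u).  Then I_q(a₀; u₁,…,u_k; a₀ q⁻ⁿ) is the sum of
-- f_{u₁}(m₁) ⋯ f_{u_k}(m_k) over 0 ≤ m₁ ≤ ⋯ ≤ m_k ≤ n, and n is unique because q is not a root of
-- unity; the second symbol of the lemma has upper index n - 1.  Since tₘ = tₘ₊₁ q we have
-- f_{uq}(m) = f_u(m + 1), so shifting the indices m_{h+1}, …, m_k up by one turns the second symbol
-- into the sum over the same tuples with m_h < m_{h+1} (reading m₀ = 0 and m_{k+1} = n).  The
-- difference is therefore the sum over the tuples with m_h = m_{h+1}.  For h = 0 this forces m₁ = 0,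
-- with factor f_{a₁}(0) = a₀/(a₀ - a₁); for h = k it forces m_k = n, with factor
-- f_{a_k}(n) = a_{k+1}/(a_{k+1} - a_k); otherwise the merged weight f_{a_h} f_{a_{h+1}} splits by
-- partial fractions into a_h/(a_h - a_{h+1}) f_{a_h} + a_{h+1}/(a_{h+1} - a_h) f_{a_{h+1}}.

open import Defs
open import Level using (Level; _⊔_)
open import Data.Nat using (ℕ; suc; _≤_; _<_; _<ᵇ_)
open import Data.Product using (_×_; Σ; proj₁; proj₂)
open import Data.Bool using (if_then_else_)
open import Relation.Nullary using (¬_)

open import Algebra.Bundles using (CommutativeRing)
open import Data.Empty using (⊥-elim)
open import Data.Integer as ℤ using (ℤ; +_; -[1+_])
import Data.Integer.Properties as ℤ
open import Data.List using (List; []; _∷_; _++_; _∷ʳ_; map; foldr; upTo; applyUpTo; filter)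
import Data.List.Properties as List
open import Data.List.Membership.Propositional using (_∈_)
open import Data.List.Membership.Propositional.Properties using (∈-map⁻; ∈-upTo⁻)
open import Data.List.Relation.Binary.Pointwise as Pointwise using (Pointwise; []; _∷_)
open import Data.List.Relation.Unary.All as All using (All; []; _∷_)
import Data.List.Relation.Unary.All.Properties as All
open import Data.List.Relation.Unary.Any using (here; there)
open import Data.Maybe using (Maybe; just; nothing)
open import Data.Nat as ℕ using (zero; z≤n; s≤s; z<s)
import Data.Nat.Properties as ℕ
open import Data.Product using (_,_)
open import Data.Sign as Sign using (Sign)
open import Data.Sum using (inj₁; inj₂)
open import Function using (_∘_)
open import Relation.Binary using (tri<; tri≈; tri>)
open import Relation.Binary.PropositionalEquality as ≡ using (_≡_; _≢_)
open import Relation.Nullary using (yes; no)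
open import Relation.Nullary.Decidable using (dec-true; dec-false; ¬?)

-- Algebra.Solver.Ring with integer coefficients, mapped into R by n ↦ n·1; the library's own
-- instances either need decidable equality or cannot subtract, and the identities below cancel terms.
module IntegerCoefficientSolver {c ℓ} (R : CommutativeRing c ℓ) where
  open CommutativeRing R
  open import Algebra.Properties.Ring ring
  open import Algebra.Properties.AbelianGroup +-abelianGroup using (⁻¹-∙-comm)
  open import Algebra.Properties.CommutativeSemigroup +-commutativeSemigroup using (interchange)
  open import Algebra.Properties.Semiring.Mult semiring using (×-homo-+; ×1-homo-*) renaming (_×_ to _⨰_)
  open import Algebra.Solver.Ring.AlmostCommutativeRing
  open import Relation.Binary.Reasoning.Setoid setoid

  ⟦_⟧ℤ : ℤ → Carrier
  ⟦ + n ⟧ℤ      = n ⨰ 1#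
  ⟦ -[1+ n ] ⟧ℤ = - (suc n ⨰ 1#)

  ⟦⊖⟧ : ∀ m n → ⟦ m ℤ.⊖ n ⟧ℤ ≈ m ⨰ 1# - n ⨰ 1#
  ⟦⊖⟧ zero    zero    = sym (-‿inverseʳ 0#)
  ⟦⊖⟧ zero    (suc n) = sym (+-identityˡ _)
  ⟦⊖⟧ (suc m) zero    = sym (trans (+-congˡ -0#≈0#) (+-identityʳ _))
  ⟦⊖⟧ (suc m) (suc n) = begin
    ⟦ suc m ℤ.⊖ suc n ⟧ℤ               ≡⟨ ≡.cong ⟦_⟧ℤ (ℤ.[1+m]⊖[1+n]≡m⊖n m n) ⟩
    ⟦ m ℤ.⊖ n ⟧ℤ                       ≈⟨ ⟦⊖⟧ m n ⟩
    m ⨰ 1# - n ⨰ 1#                    ≈⟨ +-identityˡ _ ⟨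
    0# + (m ⨰ 1# - n ⨰ 1#)             ≈⟨ +-congʳ (-‿inverseʳ 1#) ⟨
    (1# - 1#) + (m ⨰ 1# - n ⨰ 1#)      ≈⟨ interchange _ _ _ _ ⟩
    (1# + m ⨰ 1#) + (- 1# - n ⨰ 1#)    ≈⟨ +-congˡ (⁻¹-∙-comm 1# _) ⟩
    (1# + m ⨰ 1#) - (1# + n ⨰ 1#)      ∎

  signed : Sign → Carrier → Carrier
  signed Sign.+ x = x
  signed Sign.- x = - x

  signed-cong : ∀ s {x y} → x ≈ y → signed s x ≈ signed s y
  signed-cong Sign.+ x≈y = x≈y
  signed-cong Sign.- x≈y = -‿cong x≈y

  signed-* : ∀ s t x y → signed (s Sign.* t) (x * y) ≈ signed s x * signed t y
  signed-* Sign.+ Sign.+ x y = refl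
  signed-* Sign.+ Sign.- x y = -‿distribʳ-* x y
  signed-* Sign.- Sign.+ x y = -‿distribˡ-* x y
  signed-* Sign.- Sign.- x y = begin
    x * y          ≈⟨ -‿involutive _ ⟨
    - - (x * y)    ≈⟨ -‿cong (-‿distribˡ-* x y) ⟩
    - (- x * y)    ≈⟨ -‿distribʳ-* _ _ ⟩
    - x * - y      ∎

  ⟦◃⟧ : ∀ s n → ⟦ s ℤ.◃ n ⟧ℤ ≈ signed s (n ⨰ 1#)
  ⟦◃⟧ Sign.+ zero    = refl
  ⟦◃⟧ Sign.- zero    = sym -0#≈0#
  ⟦◃⟧ Sign.+ (suc n) = refl
  ⟦◃⟧ Sign.- (suc n) = refl

  ⟦⟧-signAbs : ∀ i → ⟦ i ⟧ℤ ≈ signed (ℤ.sign i) (ℤ.∣ i ∣ ⨰ 1#)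
  ⟦⟧-signAbs (+ zero)  = refl
  ⟦⟧-signAbs (+ suc n) = refl
  ⟦⟧-signAbs -[1+ n ]  = refl

  ⟦⟧-+ : ∀ i j → ⟦ i ℤ.+ j ⟧ℤ ≈ ⟦ i ⟧ℤ + ⟦ j ⟧ℤ
  ⟦⟧-+ (+ m)    (+ n)    = ×-homo-+ 1# m n
  ⟦⟧-+ (+ m)    -[1+ n ] = ⟦⊖⟧ m (suc n)
  ⟦⟧-+ -[1+ m ] (+ n)    = trans (⟦⊖⟧ n (suc m)) (+-comm _ _)
  ⟦⟧-+ -[1+ m ] -[1+ n ] = begin
    - (suc (suc (m ℕ.+ n)) ⨰ 1#)       ≡⟨ ≡.cong (λ k → - (suc k ⨰ 1#)) (ℕ.+-suc m n) ⟨
    - ((suc m ℕ.+ suc n) ⨰ 1#)         ≈⟨ -‿cong (×-homo-+ 1# (suc m) (suc n)) ⟩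
    - (suc m ⨰ 1# + suc n ⨰ 1#)        ≈⟨ ⁻¹-∙-comm _ _ ⟨
    ⟦ -[1+ m ] ⟧ℤ + ⟦ -[1+ n ] ⟧ℤ      ∎

  ⟦⟧-* : ∀ i j → ⟦ i ℤ.* j ⟧ℤ ≈ ⟦ i ⟧ℤ * ⟦ j ⟧ℤ
  ⟦⟧-* i j = begin
    ⟦ i ℤ.* j ⟧ℤ                                      ≈⟨ ⟦◃⟧ (s Sign.* t) (ℤ.∣ i ∣ ℕ.* ℤ.∣ j ∣) ⟩
    signed (s Sign.* t) ((ℤ.∣ i ∣ ℕ.* ℤ.∣ j ∣) ⨰ 1#)   ≈⟨ signed-cong (s Sign.* t) (×1-homo-* ℤ.∣ i ∣ ℤ.∣ j ∣) ⟩
    signed (s Sign.* t) (ℤ.∣ i ∣ ⨰ 1# * ℤ.∣ j ∣ ⨰ 1#)  ≈⟨ signed-* s t _ _ ⟩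
    signed s (ℤ.∣ i ∣ ⨰ 1#) * signed t (ℤ.∣ j ∣ ⨰ 1#)  ≈⟨ *-cong (⟦⟧-signAbs i) (⟦⟧-signAbs j) ⟨
    ⟦ i ⟧ℤ * ⟦ j ⟧ℤ                                    ∎
    where
    s = ℤ.sign i
    t = ℤ.sign j

  ⟦⟧-neg : ∀ i → ⟦ ℤ.- i ⟧ℤ ≈ - ⟦ i ⟧ℤ
  ⟦⟧-neg (+ zero)  = sym -0#≈0#
  ⟦⟧-neg (+ suc n) = refl
  ⟦⟧-neg -[1+ n ]  = sym (-‿involutive _)

  ℤ⟶R : ℤ.+-*-rawRing -Raw-AlmostCommutative⟶ fromCommutativeRing R
  ℤ⟶R = record
    { ⟦_⟧    = ⟦_⟧ℤ
    ; +-homo = ⟦⟧-+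
    ; *-homo = ⟦⟧-*
    ; -‿homo = ⟦⟧-neg
    ; 0-homo = refl
    ; 1-homo = +-identityʳ 1#
    }

  _≟ℤ_ : ∀ i j → Maybe (⟦ i ⟧ℤ ≈ ⟦ j ⟧ℤ)
  i ≟ℤ j with i ℤ.≟ j
  ... | yes ≡.refl = just refl
  ... | no _       = nothing

  open import Algebra.Solver.Ring ℤ.+-*-rawRing (fromCommutativeRing R) ℤ⟶R _≟ℤ_ public

applyUpTo-++ : ∀ {A : Set} (f : ℕ → A) m n →
               applyUpTo f (m ℕ.+ n) ≡ applyUpTo f m ++ applyUpTo (λ i → f (m ℕ.+ i)) n
applyUpTo-++ f zero    n = ≡.refl
applyUpTo-++ f (suc m) n = ≡.cong (f 0 ∷_) (applyUpTo-++ (f ∘ suc) m n)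

-- This is FieldDefs.range q, which does not use q: the indices lo, …, n, and [ lo ] when n < lo.
interval : ℕ → ℕ → List ℕ
interval lo n = map (lo ℕ.+_) (upTo (suc (n ℕ.∸ lo)))

interval-self : ∀ n → interval n n ≡ n ∷ []
interval-self n rewrite ℕ.n∸n≡0 n | ℕ.+-identityʳ n = ≡.refl

interval-bottom : ∀ {lo n} → lo < n → interval lo n ≡ lo ∷ interval (suc lo) n
interval-bottom {lo} {n} lo<n rewrite ℕ.+-∸-assoc 1 lo<n = ≡.cong₂ _∷_ (ℕ.+-identityʳ lo) (begin
  map (lo ℕ.+_) (applyUpTo suc (suc c))      ≡⟨ ≡.cong (map (lo ℕ.+_)) (List.map-upTo suc (suc c)) ⟨
  map (lo ℕ.+_) (map suc (upTo (suc c)))     ≡⟨ List.map-∘ _ ⟨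
  map (λ i → lo ℕ.+ suc i) (upTo (suc c))    ≡⟨ List.map-cong (ℕ.+-suc lo) _ ⟩
  map (suc lo ℕ.+_) (upTo (suc c))           ∎)
  where
  open ≡.≡-Reasoning
  c = n ℕ.∸ suc lo

interval-top : ∀ {lo n} → lo ≤ n → interval lo (suc n) ≡ interval lo n ∷ʳ suc n
interval-top {lo} {n} lo≤n rewrite ℕ.+-∸-assoc 1 lo≤n = begin
  map (lo ℕ.+_) (upTo (suc (suc c)))         ≡⟨ ≡.cong (map (lo ℕ.+_)) (List.upTo-∷ʳ (suc c)) ⟨
  map (lo ℕ.+_) (upTo (suc c) ∷ʳ suc c)      ≡⟨ List.map-++ (lo ℕ.+_) (upTo (suc c)) _ ⟩
  interval lo n ∷ʳ (lo ℕ.+ suc c)            ≡⟨ ≡.cong (interval lo n ∷ʳ_) lo+[1+c]≡1+n ⟩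
  interval lo n ∷ʳ suc n                     ∎
  where
  open ≡.≡-Reasoning
  c = n ℕ.∸ lo
  lo+[1+c]≡1+n : lo ℕ.+ suc c ≡ suc n
  lo+[1+c]≡1+n = ≡.trans (ℕ.+-suc lo c) (≡.cong suc (ℕ.m+[n∸m]≡n lo≤n))

interval-suc : ∀ lo n → interval (suc lo) (suc n) ≡ map suc (interval lo n)
interval-suc lo n = List.map-∘ (upTo (suc (n ℕ.∸ lo)))

∈-interval⁻ : ∀ {lo n m} → lo ≤ n → m ∈ interval lo n → m ≤ n
∈-interval⁻ {lo} {n} lo≤n m∈ with i , i∈ , ≡.refl ← ∈-map⁻ (lo ℕ.+_) m∈ =
  ℕ.≤-trans (ℕ.+-monoʳ-≤ lo (ℕ.s≤s⁻¹ (∈-upTo⁻ i∈))) (ℕ.≤-reflexive (ℕ.m+[n∸m]≡n lo≤n))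

module ChainSums {c ℓ} (R : CommutativeRing c ℓ) where
  open CommutativeRing R
  open import Algebra.Properties.CommutativeSemigroup +-commutativeSemigroup using (interchange)
  open import Algebra.Properties.CommutativeSemigroup *-commutativeSemigroup using (x∙yz≈y∙xz)
  open import Algebra.Properties.Group +-group using (//-rightDividesˡ; x≈y⇒x∙y⁻¹≈ε)
  open import Algebra.Properties.AbelianGroup +-abelianGroup using (xyx⁻¹≈y)
  open import Relation.Binary.Reasoning.Setoid setoid

  AgreeUpTo : ℕ → (ℕ → Carrier) → (ℕ → Carrier) → Set ℓ
  AgreeUpTo n g h = ∀ m → m ≤ n → g m ≈ h m

  agree-refl : ∀ {n g} → AgreeUpTo n g g
  agree-refl _ _ = refl

  sum : List Carrier → Carrier
  sum = foldr _+_ 0#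

  sum-++ : ∀ xs ys → sum (xs ++ ys) ≈ sum xs + sum ys
  sum-++ []       ys = sym (+-identityˡ _)
  sum-++ (x ∷ xs) ys = trans (+-congˡ (sum-++ xs ys)) (sym (+-assoc _ _ _))

  sum-map-cong : ∀ {g h : ℕ → Carrier} xs → (∀ {m} → m ∈ xs → g m ≈ h m) → sum (map g xs) ≈ sum (map h xs)
  sum-map-cong []       g≈h = refl
  sum-map-cong (x ∷ xs) g≈h = +-cong (g≈h (here ≡.refl)) (sum-map-cong xs (g≈h ∘ there))

  sum-map-+ : ∀ (g h : ℕ → Carrier) xs → sum (map (λ m → g m + h m) xs) ≈ sum (map g xs) + sum (map h xs)
  sum-map-+ g h []       = sym (+-identityˡ 0#)
  sum-map-+ g h (x ∷ xs) = trans (+-congˡ (sum-map-+ g h xs)) (interchange _ _ _ _)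

  sum-map-*ˡ : ∀ a (g : ℕ → Carrier) xs → sum (map (λ m → a * g m) xs) ≈ a * sum (map g xs)
  sum-map-*ˡ a g []       = sym (zeroʳ a)
  sum-map-*ˡ a g (x ∷ xs) = trans (+-congˡ (sum-map-*ˡ a g xs)) (sym (distribˡ a _ _))

  rangeSum : (ℕ → Carrier) → ℕ → ℕ → Carrier
  rangeSum g lo n = sum (map g (interval lo n))

  rangeSum-cong : ∀ {g h} lo n → (∀ m → g m ≈ h m) → rangeSum g lo n ≈ rangeSum h lo n
  rangeSum-cong lo n g≈h = sum-map-cong (interval lo n) (λ {m} _ → g≈h m)

  rangeSum-cong≤ : ∀ {g h lo n} → lo ≤ n → AgreeUpTo n g h → rangeSum g lo n ≈ rangeSum h lo n
  rangeSum-cong≤ {lo = lo} {n} lo≤n g≈h = sum-map-cong (interval lo n) (λ {m} → g≈h m ∘ ∈-interval⁻ lo≤n)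

  rangeSum-+ : ∀ g h lo n → rangeSum (λ m → g m + h m) lo n ≈ rangeSum g lo n + rangeSum h lo n
  rangeSum-+ g h lo n = sum-map-+ g h (interval lo n)

  rangeSum-*ˡ : ∀ a g lo n → rangeSum (λ m → a * g m) lo n ≈ a * rangeSum g lo n
  rangeSum-*ˡ a g lo n = sum-map-*ˡ a g (interval lo n)

  rangeSum-self : ∀ g n → rangeSum g n n ≈ g n
  rangeSum-self g n = trans (reflexive (≡.cong (sum ∘ map g) (interval-self n))) (+-identityʳ (g n))

  rangeSum-bottom : ∀ g {lo n} → lo < n → rangeSum g lo n ≈ g lo + rangeSum g (suc lo) n
  rangeSum-bottom g lo<n = reflexive (≡.cong (sum ∘ map g) (interval-bottom lo<n))

  rangeSum-top : ∀ g {lo n} → lo ≤ n → rangeSum g lo (suc n) ≈ rangeSum g lo n + g (suc n)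
  rangeSum-top g {lo} {n} lo≤n = begin
    rangeSum g lo (suc n)                        ≡⟨ ≡.cong (sum ∘ map g) (interval-top lo≤n) ⟩
    sum (map g (interval lo n ∷ʳ suc n))         ≡⟨ ≡.cong sum (List.map-++ g (interval lo n) _) ⟩
    sum (map g (interval lo n) ∷ʳ g (suc n))     ≈⟨ sum-++ (map g (interval lo n)) _ ⟩
    rangeSum g lo n + (g (suc n) + 0#)           ≈⟨ +-congˡ (+-identityʳ _) ⟩
    rangeSum g lo n + g (suc n)                  ∎

  rangeSum-suc : ∀ g lo n → rangeSum g (suc lo) (suc n) ≡ rangeSum (g ∘ suc) lo n
  rangeSum-suc g lo n =
    ≡.cong sum (≡.trans (≡.cong (map g) (interval-suc lo n)) (≡.sym (List.map-∘ (interval lo n))))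

  -- chainSum [g₁, …, g_k] T lo n = Σ_{lo ≤ m₁ ≤ ⋯ ≤ m_k ≤ n} g₁(m₁) ⋯ g_k(m_k) T(m_k), with m₀ = lo.
  chainSum : List (ℕ → Carrier) → (ℕ → Carrier) → ℕ → ℕ → Carrier
  chainSum []       T lo n = T lo
  chainSum (g ∷ gs) T lo n = rangeSum (λ m → g m * chainSum gs T m n) lo n

  chainSum-++ : ∀ gs hs T lo n → chainSum (gs ++ hs) T lo n ≈ chainSum gs (λ m → chainSum hs T m n) lo n
  chainSum-++ []       hs T lo n = refl
  chainSum-++ (g ∷ gs) hs T lo n = rangeSum-cong lo n (λ m → *-congˡ (chainSum-++ gs hs T m n))

  chainSum-cong : ∀ {gs hs T U lo n} → lo ≤ n → Pointwise (AgreeUpTo n) gs hs → AgreeUpTo n T U →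
                  chainSum gs T lo n ≈ chainSum hs U lo n
  chainSum-cong lo≤n []            T≈U = T≈U _ lo≤n
  chainSum-cong lo≤n (g≈h ∷ gs≈hs) T≈U =
    rangeSum-cong≤ lo≤n (λ m m≤n → *-cong (g≈h m m≤n) (chainSum-cong m≤n gs≈hs T≈U))

  chainSum-congʳ : ∀ gs {T U} lo n → (∀ m → T m ≈ U m) → chainSum gs T lo n ≈ chainSum gs U lo n
  chainSum-congʳ []       lo n T≈U = T≈U lo
  chainSum-congʳ (g ∷ gs) lo n T≈U = rangeSum-cong lo n (λ m → *-congˡ (chainSum-congʳ gs m n T≈U))

  chainSum-+ : ∀ gs T U lo n → chainSum gs (λ m → T m + U m) lo n ≈ chainSum gs T lo n + chainSum gs U lo n
  chainSum-+ []       T U lo n = refl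
  chainSum-+ (g ∷ gs) T U lo n = trans
    (rangeSum-cong lo n (λ m → trans (*-congˡ (chainSum-+ gs T U m n)) (distribˡ _ _ _)))
    (rangeSum-+ _ _ lo n)

  chainSum-*ˡ : ∀ gs a T lo n → chainSum gs (λ m → a * T m) lo n ≈ a * chainSum gs T lo n
  chainSum-*ˡ []       a T lo n = refl
  chainSum-*ˡ (g ∷ gs) a T lo n = trans
    (rangeSum-cong lo n (λ m → trans (*-congˡ (chainSum-*ˡ gs a T m n)) (x∙yz≈y∙xz _ _ _)))
    (rangeSum-*ˡ a _ lo n)

  chainSum-suc : ∀ gs T lo n → chainSum (map (_∘ suc) gs) (T ∘ suc) lo n ≈ chainSum gs T (suc lo) (suc n)
  chainSum-suc []       T lo n = refl
  chainSum-suc (g ∷ gs) T lo n = begin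
    rangeSum (λ m → g (suc m) * chainSum (map (_∘ suc) gs) (T ∘ suc) m n) lo n
      ≈⟨ rangeSum-cong lo n (λ m → *-congˡ (chainSum-suc gs T m n)) ⟩
    rangeSum (λ m → g (suc m) * chainSum gs T (suc m) (suc n)) lo n
      ≡⟨ rangeSum-suc (λ m → g m * chainSum gs T m (suc n)) lo n ⟨
    chainSum (g ∷ gs) T (suc lo) (suc n) ∎

  chainSum-extend : ∀ gs {T U lo N} → lo ≤ N → AgreeUpTo N T U → U (suc N) ≈ 0# →
                    chainSum gs T lo N ≈ chainSum gs U lo (suc N)
  chainSum-extend []       lo≤N T≈U U₀ = T≈U _ lo≤N
  chainSum-extend (g ∷ gs) {T} {U} {lo} {N} lo≤N T≈U U₀ = begin
    rangeSum (λ m → g m * chainSum gs T m N) lo N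
      ≈⟨ rangeSum-cong≤ lo≤N (λ m m≤N → *-congˡ (chainSum-extend gs m≤N T≈U U₀)) ⟩
    rangeSum G lo N                  ≈⟨ +-identityʳ _ ⟨
    rangeSum G lo N + 0#             ≈⟨ +-congˡ (trans (*-congˡ (at-top gs)) (zeroʳ _)) ⟨
    rangeSum G lo N + G (suc N)      ≈⟨ rangeSum-top G lo≤N ⟨
    rangeSum G lo (suc N)            ∎
    where
    G : ℕ → Carrier
    G m = g m * chainSum gs U m (suc N)
    at-top : ∀ hs → chainSum hs U (suc N) (suc N) ≈ 0#
    at-top []       = U₀
    at-top (h ∷ hs) = trans (rangeSum-self _ (suc N)) (trans (*-congˡ (at-top hs)) (zeroʳ _))

  chainSum-split-top : ∀ gs {E D V lo N} → lo ≤ N → AgreeUpTo N E (λ m → D m + V m) → E (suc N) ≈ D (suc N) →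
                       chainSum gs E lo (suc N) ≈ chainSum gs D lo (suc N) + chainSum gs V lo N
  chainSum-split-top gs {E} {D} {V} {lo} {N} lo≤N E≈D+V E≈D = begin
    chainSum gs E lo (suc N)                            ≈⟨ chainSum-congʳ gs lo (suc N) E≈D+[E-D] ⟩
    chainSum gs (λ m → D m + (E m - D m)) lo (suc N)    ≈⟨ chainSum-+ gs D (λ m → E m - D m) lo (suc N) ⟩
    chainSum gs D lo (suc N) + chainSum gs (λ m → E m - D m) lo (suc N)
      ≈⟨ +-congˡ (chainSum-extend gs lo≤N V≈E-D (x≈y⇒x∙y⁻¹≈ε E≈D)) ⟨
    chainSum gs D lo (suc N) + chainSum gs V lo N       ∎
    where
    E≈D+[E-D] : ∀ m → E m ≈ D m + (E m - D m)
    E≈D+[E-D] m = trans (sym (//-rightDividesˡ (D m) (E m))) (+-comm _ _)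
    V≈E-D : AgreeUpTo N V (λ m → E m - D m)
    V≈E-D m m≤N = sym (trans (+-congʳ (E≈D+V m m≤N)) (xyx⁻¹≈y (D m) (V m)))

  chainSum-snoc : ∀ gs (p : ℕ → Carrier) hs T lo n →
    chainSum (gs ++ p ∷ hs) T lo n ≈ chainSum (gs ++ p ∷ []) (λ m → chainSum hs T m n) lo n
  chainSum-snoc gs p hs T lo n = trans (chainSum-++ gs (p ∷ hs) T lo n) (sym (chainSum-++ gs (p ∷ []) _ lo n))

  chainSum-merge : ∀ gs (p g : ℕ → Carrier) hs T lo n →
    chainSum (gs ++ p ∷ []) (λ m → g m * chainSum hs T m n) lo n
      ≈ chainSum (gs ++ (λ m → p m * g m) ∷ hs) T lo n
  chainSum-merge gs p g hs T lo n = begin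
    chainSum (gs ++ p ∷ []) (λ m → g m * chainSum hs T m n) lo n
      ≈⟨ chainSum-++ gs (p ∷ []) _ lo n ⟩
    chainSum gs (λ m → chainSum (p ∷ []) (λ m → g m * chainSum hs T m n) m n) lo n
      ≈⟨ chainSum-congʳ gs lo n (λ m → rangeSum-cong m n (λ m′ → sym (*-assoc (p m′) (g m′) _))) ⟩
    chainSum gs (λ m → chainSum ((λ m → p m * g m) ∷ hs) T m n) lo n
      ≈⟨ chainSum-++ gs _ T lo n ⟨
    chainSum (gs ++ (λ m → p m * g m) ∷ hs) T lo n ∎

  chainSum-bottom : ∀ g gs T {lo N} → lo ≤ N →
    chainSum (g ∷ gs) T lo (suc N)
      ≈ g lo * chainSum gs T lo (suc N) + chainSum (map (_∘ suc) (g ∷ gs)) (T ∘ suc) lo N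
  chainSum-bottom g gs T lo≤N =
    trans (rangeSum-bottom _ (s≤s lo≤N)) (+-congˡ (sym (chainSum-suc (g ∷ gs) T _ _)))

  chainSum-tie : ∀ gs (p g : ℕ → Carrier) hs T {lo N} → lo ≤ N →
    chainSum (gs ++ p ∷ g ∷ hs) T lo (suc N)
      ≈ chainSum (gs ++ (λ m → p m * g m) ∷ hs) T lo (suc N)
        + chainSum (gs ++ p ∷ map (_∘ suc) (g ∷ hs)) (T ∘ suc) lo N
  chainSum-tie gs p g hs T {lo} {N} lo≤N = begin
    chainSum (gs ++ p ∷ g ∷ hs) T lo (suc N)
      ≈⟨ chainSum-snoc gs p (g ∷ hs) T lo (suc N) ⟩
    chainSum (gs ++ p ∷ []) (λ m → chainSum (g ∷ hs) T m (suc N)) lo (suc N)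
      ≈⟨ chainSum-split-top (gs ++ p ∷ []) lo≤N (λ _ m≤N → chainSum-bottom g hs T m≤N) (rangeSum-self _ (suc N)) ⟩
    chainSum (gs ++ p ∷ []) (λ m → g m * chainSum hs T m (suc N)) lo (suc N)
      + chainSum (gs ++ p ∷ []) (λ m → chainSum (map (_∘ suc) (g ∷ hs)) (T ∘ suc) m N) lo N
      ≈⟨ +-cong (chainSum-merge gs p g hs T lo (suc N)) (sym (chainSum-snoc gs p _ (T ∘ suc) lo N)) ⟩
    chainSum (gs ++ (λ m → p m * g m) ∷ hs) T lo (suc N)
      + chainSum (gs ++ p ∷ map (_∘ suc) (g ∷ hs)) (T ∘ suc) lo N ∎

  chainSum-last : ∀ gs g T {lo N} → lo ≤ N →
    chainSum (gs ++ g ∷ []) T lo (suc N)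
      ≈ g (suc N) * T (suc N) * chainSum gs (λ _ → 1#) lo (suc N) + chainSum (gs ++ g ∷ []) T lo N
  chainSum-last gs g T {lo} {N} lo≤N = begin
    chainSum (gs ++ g ∷ []) T lo (suc N)
      ≈⟨ chainSum-++ gs (g ∷ []) T lo (suc N) ⟩
    chainSum gs (λ m → chainSum (g ∷ []) T m (suc N)) lo (suc N)
      ≈⟨ chainSum-split-top gs lo≤N (λ _ m≤N → trans (rangeSum-top _ m≤N) (+-comm _ _)) (rangeSum-self _ (suc N)) ⟩
    chainSum gs (λ _ → a) lo (suc N) + chainSum gs (λ m → chainSum (g ∷ []) T m N) lo N
      ≈⟨ +-cong (chainSum-congʳ gs lo (suc N) (λ _ → sym (*-identityʳ a))) (sym (chainSum-++ gs (g ∷ []) T lo N)) ⟩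
    chainSum gs (λ _ → a * 1#) lo (suc N) + chainSum (gs ++ g ∷ []) T lo N
      ≈⟨ +-congʳ (chainSum-*ˡ gs a (λ _ → 1#) lo (suc N)) ⟩
    a * chainSum gs (λ _ → 1#) lo (suc N) + chainSum (gs ++ g ∷ []) T lo N ∎
    where
    a : Carrier
    a = g (suc N) * T (suc N)

  chainSum-linear : ∀ gs {w} g h hs T α β {lo n} → lo ≤ n → AgreeUpTo n w (λ m → α * g m + β * h m) →
    chainSum (gs ++ w ∷ hs) T lo n ≈ α * chainSum (gs ++ g ∷ hs) T lo n + β * chainSum (gs ++ h ∷ hs) T lo n
  chainSum-linear gs {w} g h hs T α β {lo} {n} lo≤n w≈αg+βh = begin
    chainSum (gs ++ w ∷ hs) T lo n
      ≈⟨ chainSum-++ gs _ T lo n ⟩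
    chainSum gs (λ m → chainSum (w ∷ hs) T m n) lo n
      ≈⟨ chainSum-cong {gs = gs} lo≤n (Pointwise.refl agree-refl) split ⟩
    chainSum gs (λ m → α * G m + β * H m) lo n
      ≈⟨ chainSum-+ gs _ _ lo n ⟩
    chainSum gs (λ m → α * G m) lo n + chainSum gs (λ m → β * H m) lo n
      ≈⟨ +-cong (chainSum-*ˡ gs α G lo n) (chainSum-*ˡ gs β H lo n) ⟩
    α * chainSum gs G lo n + β * chainSum gs H lo n
      ≈⟨ +-cong (*-congˡ (chainSum-++ gs _ T lo n)) (*-congˡ (chainSum-++ gs _ T lo n)) ⟨
    α * chainSum (gs ++ g ∷ hs) T lo n + β * chainSum (gs ++ h ∷ hs) T lo n ∎
    where
    G H : ℕ → Carrier
    G m = chainSum (g ∷ hs) T m n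
    H m = chainSum (h ∷ hs) T m n
    expand : ∀ m x → (α * g m + β * h m) * x ≈ α * (g m * x) + β * (h m * x)
    expand m x = trans (distribʳ x _ _) (+-cong (*-assoc α _ x) (*-assoc β _ x))
    split : AgreeUpTo n (λ m → chainSum (w ∷ hs) T m n) (λ m → α * G m + β * H m)
    split m m≤n = begin
      rangeSum (λ m′ → w m′ * chainSum hs T m′ n) m n
        ≈⟨ rangeSum-cong≤ m≤n (λ m′ m′≤n → trans (*-congʳ (w≈αg+βh m′ m′≤n)) (expand m′ _)) ⟩
      rangeSum (λ m′ → α * (g m′ * chainSum hs T m′ n) + β * (h m′ * chainSum hs T m′ n)) m n
        ≈⟨ rangeSum-+ _ _ m n ⟩
      rangeSum (λ m′ → α * (g m′ * chainSum hs T m′ n)) m n + rangeSum (λ m′ → β * (h m′ * chainSum hs T m′ n)) m n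
        ≈⟨ +-cong (rangeSum-*ˡ α _ m n) (rangeSum-*ˡ β _ m n) ⟩
      α * G m + β * H m ∎

module FieldProperties {c ℓ} (F : Field c ℓ) where
  open Field F
  open FieldDefs F
  open IntegerCoefficientSolver commutativeRing using (solve; _:+_; _:*_; _:-_; _:=_)
  open import Algebra.Properties.Group +-group using (x∙y⁻¹≈ε⇒x≈y)
  open import Algebra.Properties.CommutativeSemigroup *-commutativeSemigroup
    using (xy∙z≈xz∙y) renaming (interchange to *-interchange)
  open import Relation.Binary.Reasoning.Setoid setoid

  ÷-*-cancel : ∀ x {y} → ¬ y ≈ 0# → (x ÷ y) * y ≈ x
  ÷-*-cancel x {y} y≉0 = begin
    x * inv y * y      ≈⟨ *-assoc x (inv y) y ⟩
    x * (inv y * y)    ≈⟨ *-congˡ (trans (*-comm _ _) (inverse y y≉0)) ⟩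
    x * 1#             ≈⟨ *-identityʳ x ⟩
    x                  ∎

  *-÷-cancel : ∀ x {y} → ¬ y ≈ 0# → (x * y) ÷ y ≈ x
  *-÷-cancel x {y} y≉0 = begin
    x * y * inv y      ≈⟨ *-assoc x y (inv y) ⟩
    x * (y * inv y)    ≈⟨ *-congˡ (inverse y y≉0) ⟩
    x * 1#             ≈⟨ *-identityʳ x ⟩
    x                  ∎

  *-cancelʳ : ∀ {x y z} → ¬ z ≈ 0# → x * z ≈ y * z → x ≈ y
  *-cancelʳ {x} {y} {z} z≉0 xz≈yz = begin
    x                  ≈⟨ *-÷-cancel x z≉0 ⟨
    (x * z) ÷ z        ≈⟨ *-congʳ xz≈yz ⟩
    (y * z) ÷ z        ≈⟨ *-÷-cancel y z≉0 ⟩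
    y                  ∎

  *-cancelˡ : ∀ {x y z} → ¬ x ≈ 0# → x * y ≈ x * z → y ≈ z
  *-cancelˡ x≉0 xy≈xz = *-cancelʳ x≉0 (trans (*-comm _ _) (trans xy≈xz (*-comm _ _)))

  *-nonzero : ∀ {x y} → ¬ x ≈ 0# → ¬ y ≈ 0# → ¬ x * y ≈ 0#
  *-nonzero {x} {y} x≉0 y≉0 xy≈0 = x≉0 (begin
    x                  ≈⟨ *-÷-cancel x y≉0 ⟨
    (x * y) ÷ y        ≈⟨ *-congʳ xy≈0 ⟩
    0# * inv y         ≈⟨ zeroˡ (inv y) ⟩
    0#                 ∎)

  x≉y⇒x-y≉0 : ∀ {x y} → ¬ x ≈ y → ¬ x - y ≈ 0#
  x≉y⇒x-y≉0 {x} {y} x≉y = x≉y ∘ x∙y⁻¹≈ε⇒x≈y x y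

  ÷-*-comm : ∀ x y z → (x ÷ y) * z ≈ (x * z) ÷ y
  ÷-*-comm x y z = xy∙z≈xz∙y x (inv y) z

  ÷-cancelʳ : ∀ x {y z} → ¬ y ≈ 0# → ¬ z ≈ 0# → (x * z) ÷ (y * z) ≈ x ÷ y
  ÷-cancelʳ x {y} {z} y≉0 z≉0 = *-cancelʳ yz≉0 (begin
    (x * z) ÷ (y * z) * (y * z)    ≈⟨ ÷-*-cancel (x * z) yz≉0 ⟩
    x * z                          ≈⟨ *-congʳ (÷-*-cancel x y≉0) ⟨
    (x ÷ y) * y * z                ≈⟨ *-assoc (x ÷ y) y z ⟩
    (x ÷ y) * (y * z)              ∎)
    where
    yz≉0 = *-nonzero y≉0 z≉0

  -- After multiplying by a - b both sides become t f - t g, using f (t - a) = t = g (t - b).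
  partial-fractions : ∀ {t a b} → ¬ t ≈ a → ¬ t ≈ b → ¬ a ≈ b →
    (t ÷ (t - a)) * (t ÷ (t - b)) ≈ (a ÷ (a - b)) * (t ÷ (t - a)) + (b ÷ (b - a)) * (t ÷ (t - b))
  partial-fractions {t} {a} {b} t≉a t≉b a≉b = *-cancelʳ (x≉y⇒x-y≉0 a≉b) (begin
    (f * g) * (a - b)
      ≈⟨ solve 5 (λ f g t a b → (f :* g) :* (a :- b) := f :* (g :* (t :- b)) :- g :* (f :* (t :- a))) refl f g t a b ⟩
    f * (g * (t - b)) - g * (f * (t - a))
      ≈⟨ +-cong (*-congˡ g[t-b]≈t) (-‿cong (*-congˡ f[t-a]≈t)) ⟩
    f * t - g * t
      ≈⟨ solve 3 (λ f g t → f :* t :- g :* t := (t :* f :- t) :- (t :* g :- t)) refl f g t ⟩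
    (t * f - t) - (t * g - t)
      ≈⟨ +-cong (+-congˡ (-‿cong f[t-a]≈t)) (-‿cong (+-congˡ (-‿cong g[t-b]≈t))) ⟨
    (t * f - f * (t - a)) - (t * g - g * (t - b))
      ≈⟨ solve 5 (λ f g t a b → (t :* f :- f :* (t :- a)) :- (t :* g :- g :* (t :- b)) := a :* f :- b :* g)
               refl f g t a b ⟩
    a * f - b * g
      ≈⟨ +-cong (*-congʳ α[a-b]≈a) (-‿cong (*-congʳ β[b-a]≈b)) ⟨
    (α * (a - b)) * f - (β * (b - a)) * g
      ≈⟨ solve 6 (λ α β f g a b → (α :* (a :- b)) :* f :- (β :* (b :- a)) :* g := (α :* f :+ β :* g) :* (a :- b))
               refl α β f g a b ⟩
    (α * f + β * g) * (a - b) ∎)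
    where
    f = t ÷ (t - a)
    g = t ÷ (t - b)
    α = a ÷ (a - b)
    β = b ÷ (b - a)
    f[t-a]≈t : f * (t - a) ≈ t
    f[t-a]≈t = ÷-*-cancel t (x≉y⇒x-y≉0 t≉a)
    g[t-b]≈t : g * (t - b) ≈ t
    g[t-b]≈t = ÷-*-cancel t (x≉y⇒x-y≉0 t≉b)
    α[a-b]≈a : α * (a - b) ≈ a
    α[a-b]≈a = ÷-*-cancel a (x≉y⇒x-y≉0 a≉b)
    β[b-a]≈b : β * (b - a) ≈ b
    β[b-a]≈b = ÷-*-cancel b (x≉y⇒x-y≉0 (a≉b ∘ sym))

  pow-+ : ∀ x m n → pow x (m ℕ.+ n) ≈ pow x m * pow x n
  pow-+ x zero    n = sym (*-identityˡ _)
  pow-+ x (suc m) n = trans (*-congʳ (pow-+ x m n)) (xy∙z≈xz∙y _ _ x)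

  pow-*-pow-inv : ∀ {x} → ¬ x ≈ 0# → ∀ n → pow x n * pow (inv x) n ≈ 1#
  pow-*-pow-inv     x≉0 zero    = *-identityʳ 1#
  pow-*-pow-inv {x} x≉0 (suc n) = begin
    (pow x n * x) * (pow (inv x) n * inv x)      ≈⟨ *-interchange _ _ _ _ ⟩
    (pow x n * pow (inv x) n) * (x * inv x)      ≈⟨ *-cong (pow-*-pow-inv x≉0 n) (inverse x x≉0) ⟩
    1# * 1#                                      ≈⟨ *-identityʳ 1# ⟩
    1#                                           ∎

  pow-inv-nonzero : ∀ {x} → ¬ x ≈ 0# → ∀ n → ¬ pow (inv x) n ≈ 0#
  pow-inv-nonzero {x} x≉0 n pow≈0 = 0≉1 (begin
    0#                          ≈⟨ zeroʳ (pow x n) ⟨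
    pow x n * 0#                ≈⟨ *-congˡ pow≈0 ⟨
    pow x n * pow (inv x) n     ≈⟨ pow-*-pow-inv x≉0 n ⟩
    1#                          ∎)

  pow-inv-aperiodic : ∀ {q} → ¬ q ≈ 0# → (∀ N → ¬ pow q (suc N) ≈ 1#) →
                      ∀ m d → ¬ pow (inv q) m ≈ pow (inv q) (suc m ℕ.+ d)
  pow-inv-aperiodic {q} q≉0 aperiodic m d rᵐ≈rᵐ⁺ᵈ⁺¹ = aperiodic d (begin
    pow q (suc d)                         ≈⟨ *-identityʳ _ ⟨
    pow q (suc d) * 1#                    ≈⟨ *-congˡ rᵈ⁺¹≈1 ⟨
    pow q (suc d) * pow (inv q) (suc d)   ≈⟨ pow-*-pow-inv q≉0 (suc d) ⟩
    1#                                    ∎)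
    where
    r = inv q
    rᵈ⁺¹≈1 : pow r (suc d) ≈ 1#
    rᵈ⁺¹≈1 = *-cancelʳ (pow-inv-nonzero q≉0 m) (begin
      pow r (suc d) * pow r m    ≈⟨ *-comm _ _ ⟩
      pow r m * (pow r d * r)    ≈⟨ *-assoc _ _ _ ⟨
      pow r m * pow r d * r      ≈⟨ *-congʳ (pow-+ r m d) ⟨
      pow r (suc m ℕ.+ d)        ≈⟨ rᵐ≈rᵐ⁺ᵈ⁺¹ ⟨
      pow r m                    ≈⟨ *-identityˡ _ ⟨
      1# * pow r m               ∎)

  pow-inv-injective : ∀ {q} → ¬ q ≈ 0# → (∀ N → ¬ pow q (suc N) ≈ 1#) →
                      ∀ {m n} → pow (inv q) m ≈ pow (inv q) n → m ≡ n
  pow-inv-injective q≉0 aperiodic {m} {n} rᵐ≈rⁿ with ℕ.<-cmp m n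
  ... | tri≈ _ m≡n _ = m≡n
  ... | tri< m<n _ _ with d , ≡.refl ← ℕ.m≤n⇒∃[o]m+o≡n m<n =
    ⊥-elim (pow-inv-aperiodic q≉0 aperiodic m d rᵐ≈rⁿ)
  ... | tri> _ _ n<m with d , ≡.refl ← ℕ.m≤n⇒∃[o]m+o≡n n<m =
    ⊥-elim (pow-inv-aperiodic q≉0 aperiodic n d (sym rᵐ≈rⁿ))

module QChains {c ℓ} (F : Field c ℓ) (q : Field.Carrier F) (q≉0 : ¬ Field._≈_ F q (Field.0# F))
               (x : Field.Carrier F) where
  open Field F
  open FieldDefs F
  open FieldProperties F
  open ChainSums commutativeRing
  open import Algebra.Properties.Ring ring using ([y-z]x≈yx-zx)
  open import Relation.Binary.Reasoning.Setoid setoid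

  point : ℕ → Carrier
  point m = x * pow (inv q) m

  factor : Carrier → ℕ → Carrier
  factor u m = point m ÷ (point m - u)

  C : List Carrier → ℕ → ℕ → Carrier
  C = chain q x

  Avoids : ℕ → List Carrier → Set (c ⊔ ℓ)
  Avoids n us = ∀ m → m ≤ n → All (λ u → ¬ point m ≈ u) us

  chain≈chainSum : ∀ us lo n → C us lo n ≈ chainSum (map factor us) (λ _ → 1#) lo n
  chain≈chainSum []       lo n = refl
  chain≈chainSum (u ∷ us) lo n = rangeSum-cong lo n (λ m → *-congˡ (chain≈chainSum us m n))

  chain-++≈ : ∀ us vs lo n → C (us ++ vs) lo n ≈ chainSum (map factor us ++ map factor vs) (λ _ → 1#) lo n
  chain-++≈ us vs lo n = trans (chain≈chainSum (us ++ vs) lo n)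
    (reflexive (≡.cong (λ gs → chainSum gs (λ _ → 1#) lo n) (List.map-++ factor us vs)))

  point-suc : ∀ m → point m ≈ point (suc m) * q
  point-suc m = begin
    x * pow (inv q) m                  ≈⟨ *-identityʳ _ ⟨
    x * pow (inv q) m * 1#             ≈⟨ *-congˡ (trans (*-comm _ _) (inverse q q≉0)) ⟨
    x * pow (inv q) m * (inv q * q)    ≈⟨ *-assoc _ _ _ ⟨
    x * pow (inv q) m * inv q * q      ≈⟨ *-congʳ (*-assoc _ _ _) ⟩
    point (suc m) * q                  ∎

  factor-shift : ∀ {u} m → ¬ point (suc m) ≈ u → factor (u * q) m ≈ factor u (suc m)
  factor-shift {u} m p≉u = begin
    point m ÷ (point m - u * q)
      ≈⟨ *-cong (point-suc m) (inv-cong (+-congʳ (point-suc m))) ⟩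
    (point (suc m) * q) ÷ (point (suc m) * q - u * q)
      ≈⟨ *-congˡ (inv-cong ([y-z]x≈yx-zx q _ u)) ⟨
    (point (suc m) * q) ÷ ((point (suc m) - u) * q)
      ≈⟨ ÷-cancelʳ (point (suc m)) (x≉y⇒x-y≉0 p≉u) q≉0 ⟩
    factor u (suc m) ∎

  factors-shift : ∀ {N} us → Avoids (suc N) us →
    Pointwise (AgreeUpTo N) (map factor (map (_* q) us)) (map (_∘ suc) (map factor us))
  factors-shift []       avoids = []
  factors-shift (u ∷ us) avoids =
    (λ m m≤N → factor-shift m (All.head (avoids (suc m) (s≤s m≤N))))
    ∷ factors-shift us (λ m m≤ → All.tail (avoids m m≤))

  avoids-between : ∀ {y n us} → y ≈ point n → (∀ t → _⊴_ q x t → _⊴_ q t y → All (λ u → ¬ t ≈ u) us) →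
                   Avoids n us
  avoids-between {y} {n} y≈ avoid m m≤n = avoid (point m) (m , refl) (n ℕ.∸ m , (begin
    y                                              ≈⟨ y≈ ⟩
    x * pow (inv q) n                              ≡⟨ ≡.cong (λ k → x * pow (inv q) k) (ℕ.m+[n∸m]≡n m≤n) ⟨
    x * pow (inv q) (m ℕ.+ (n ℕ.∸ m))              ≈⟨ *-congˡ (pow-+ (inv q) m (n ℕ.∸ m)) ⟩
    x * (pow (inv q) m * pow (inv q) (n ℕ.∸ m))    ≈⟨ *-assoc _ _ _ ⟨
    point m * pow (inv q) (n ℕ.∸ m)                ∎))

  exponent-suc : ¬ x ≈ 0# → (∀ N → ¬ pow q (suc N) ≈ 1#) →
                 ∀ {y n N} → y ≈ point n → y * q ≈ point N → n ≡ suc N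
  exponent-suc x≉0 aperiodic {y} {n} {N} y≈ yq≈ = ≡.sym (pow-inv-injective q≉0 aperiodic (*-cancelˡ x≉0 (begin
    x * (pow (inv q) N * inv q)      ≈⟨ *-assoc _ _ _ ⟨
    point N * inv q                  ≈⟨ *-congʳ yq≈ ⟨
    y * q * inv q                    ≈⟨ *-÷-cancel y q≉0 ⟩
    y                                ≈⟨ y≈ ⟩
    point n                          ∎)))

  chain-bottom : ∀ {N} u us → Avoids (suc N) (u ∷ us) →
    C (u ∷ us) 0 (suc N) ≈ (x ÷ (x - u)) * C us 0 (suc N) + C (map (_* q) (u ∷ us)) 0 N
  chain-bottom {N} u us avoids = begin
    C (u ∷ us) 0 (suc N)
      ≈⟨ chain≈chainSum (u ∷ us) 0 (suc N) ⟩
    chainSum (factor u ∷ map factor us) (λ _ → 1#) 0 (suc N)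
      ≈⟨ chainSum-bottom (factor u) (map factor us) (λ _ → 1#) z≤n ⟩
    factor u 0 * chainSum (map factor us) (λ _ → 1#) 0 (suc N)
      + chainSum (map (_∘ suc) (map factor (u ∷ us))) (λ _ → 1#) 0 N
      ≈⟨ +-cong (*-cong factor-zero (sym (chain≈chainSum us 0 (suc N)))) (sym shifted-tail) ⟩
    (x ÷ (x - u)) * C us 0 (suc N) + C (map (_* q) (u ∷ us)) 0 N ∎
    where
    factor-zero : factor u 0 ≈ x ÷ (x - u)
    factor-zero = *-cong (*-identityʳ x) (inv-cong (+-congʳ (*-identityʳ x)))
    shifted-tail : C (map (_* q) (u ∷ us)) 0 N ≈ chainSum (map (_∘ suc) (map factor (u ∷ us))) (λ _ → 1#) 0 N
    shifted-tail = trans (chain≈chainSum (map (_* q) (u ∷ us)) 0 N)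
      (chainSum-cong {T = λ _ → 1#} z≤n (factors-shift (u ∷ us) avoids) agree-refl)

  chain-tie : ∀ {N} ps a b us → Avoids (suc N) (a ∷ b ∷ us) → ¬ a ≈ b →
    C (ps ++ a ∷ b ∷ us) 0 (suc N)
      ≈ ((a ÷ (a - b)) * C (ps ++ a ∷ us) 0 (suc N) + (b ÷ (b - a)) * C (ps ++ b ∷ us) 0 (suc N))
        + C (ps ++ a ∷ map (_* q) (b ∷ us)) 0 N
  chain-tie {N} ps a b us avoids a≉b = begin
    C (ps ++ a ∷ b ∷ us) 0 (suc N)
      ≈⟨ chain-++≈ ps (a ∷ b ∷ us) 0 (suc N) ⟩
    chainSum (Ps ++ fa ∷ fb ∷ Us) (λ _ → 1#) 0 (suc N)
      ≈⟨ chainSum-tie Ps fa fb Us _ z≤n ⟩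
    chainSum (Ps ++ (λ m → fa m * fb m) ∷ Us) (λ _ → 1#) 0 (suc N)
      + chainSum (Ps ++ fa ∷ map (_∘ suc) (fb ∷ Us)) (λ _ → 1#) 0 N
      ≈⟨ +-cong (chainSum-linear Ps fa fb Us _ α β z≤n fafb≈αfa+βfb) (sym shifted-tail) ⟩
    (α * chainSum (Ps ++ fa ∷ Us) (λ _ → 1#) 0 (suc N) + β * chainSum (Ps ++ fb ∷ Us) (λ _ → 1#) 0 (suc N))
      + C (ps ++ a ∷ map (_* q) (b ∷ us)) 0 N
      ≈⟨ +-congʳ (+-cong (*-congˡ (chain-++≈ ps (a ∷ us) 0 (suc N))) (*-congˡ (chain-++≈ ps (b ∷ us) 0 (suc N)))) ⟨
    (α * C (ps ++ a ∷ us) 0 (suc N) + β * C (ps ++ b ∷ us) 0 (suc N)) + C (ps ++ a ∷ map (_* q) (b ∷ us)) 0 N ∎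
    where
    Ps = map factor ps
    Us = map factor us
    fa = factor a
    fb = factor b
    α = a ÷ (a - b)
    β = b ÷ (b - a)
    fafb≈αfa+βfb : AgreeUpTo (suc N) (λ m → fa m * fb m) (λ m → α * fa m + β * fb m)
    fafb≈αfa+βfb m m≤ with p≉a ∷ p≉b ∷ _ ← avoids m m≤ = partial-fractions p≉a p≉b a≉b
    shifted-tail : C (ps ++ a ∷ map (_* q) (b ∷ us)) 0 N ≈ chainSum (Ps ++ fa ∷ map (_∘ suc) (fb ∷ Us)) (λ _ → 1#) 0 N
    shifted-tail = trans (chain-++≈ ps (a ∷ map (_* q) (b ∷ us)) 0 N) (chainSum-cong {T = λ _ → 1#} z≤n
      (Pointwise.++⁺ (Pointwise.refl agree-refl {Ps}) (agree-refl ∷ factors-shift (b ∷ us) (λ m m≤ → All.tail (avoids m m≤))))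
      agree-refl)

  chain-last : ∀ {N} ps a → C (ps ++ a ∷ []) 0 (suc N) ≈ factor a (suc N) * C ps 0 (suc N) + C (ps ++ a ∷ []) 0 N
  chain-last {N} ps a = begin
    C (ps ++ a ∷ []) 0 (suc N)
      ≈⟨ chain-++≈ ps (a ∷ []) 0 (suc N) ⟩
    chainSum (map factor ps ++ factor a ∷ []) (λ _ → 1#) 0 (suc N)
      ≈⟨ chainSum-last (map factor ps) (factor a) _ z≤n ⟩
    factor a (suc N) * 1# * chainSum (map factor ps) (λ _ → 1#) 0 (suc N)
      + chainSum (map factor ps ++ factor a ∷ []) (λ _ → 1#) 0 N
      ≈⟨ +-cong (*-cong (*-identityʳ _) (sym (chain≈chainSum ps 0 (suc N)))) (sym (chain-++≈ ps (a ∷ []) 0 N)) ⟩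
    factor a (suc N) * C ps 0 (suc N) + C (ps ++ a ∷ []) 0 N ∎

module EntryLists {c ℓ} (F : Field c ℓ) where
  open Field F using (Carrier; _*_)
  open FieldDefs F
  open ≡.≡-Reasoning

  later : ℕ → ℕ → List ℕ
  later h c = applyUpTo (λ i → suc (h ℕ.+ suc i)) c

  idx-split : ∀ h c → idx (h ℕ.+ suc c) ≡ idx h ++ suc h ∷ later h c
  idx-split h c = begin
    idx (h ℕ.+ suc c)                               ≡⟨ List.map-upTo suc (h ℕ.+ suc c) ⟩
    applyUpTo suc (h ℕ.+ suc c)                     ≡⟨ applyUpTo-++ suc h (suc c) ⟩
    applyUpTo suc h ++ suc (h ℕ.+ 0) ∷ later h c
      ≡⟨ ≡.cong₂ (λ is i → is ++ suc i ∷ later h c) (List.map-upTo suc h) (≡.sym (ℕ.+-identityʳ h)) ⟨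
    idx h ++ suc h ∷ later h c                      ∎

  idx-suc : ∀ h → idx (suc h) ≡ idx h ∷ʳ suc h
  idx-suc h = begin
    idx (suc h)                  ≡⟨ List.map-upTo suc (suc h) ⟩
    applyUpTo suc (suc h)        ≡⟨ List.applyUpTo-∷ʳ suc h ⟨
    applyUpTo suc h ∷ʳ suc h     ≡⟨ ≡.cong (_∷ʳ suc h) (List.map-upTo suc h) ⟨
    idx h ∷ʳ suc h               ∎

  idx-bounded : ∀ h → All (_≤ h) (idx h)
  idx-bounded h = All.map⁺ (All.applyUpTo⁺₁ (λ i → i) h (λ i<h → i<h))

  later-bounded : ∀ h c → All (suc h <_) (later h c)
  later-bounded h c = All.applyUpTo⁺₁ _ c (λ _ → s≤s (ℕ.m<m+n h z<s))

  shifted-split : ∀ q a {k h xs ys} → idx k ≡ xs ++ ys → All (_≤ h) xs → All (h <_) ys →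
                  shifted q a k h ≡ map a xs ++ map (_* q) (map a ys)
  shifted-split q a {k} {h} {xs} {ys} idx≡ xs≤h h<ys = begin
    map select (idx k)                      ≡⟨ ≡.cong (map select) idx≡ ⟩
    map select (xs ++ ys)                   ≡⟨ List.map-++ select xs ys ⟩
    map select xs ++ map select ys          ≡⟨ ≡.cong₂ _++_ (List.map-cong-local (All.map kept xs≤h))
                                                            (List.map-cong-local (All.map scaled h<ys)) ⟩
    map a xs ++ map (λ j → a j * q) ys      ≡⟨ ≡.cong (map a xs ++_) (List.map-∘ ys) ⟩
    map a xs ++ map (_* q) (map a ys)       ∎
    where
    select : ℕ → Carrier
    select j = if j ℕ.≤ᵇ h then a j else a j * q
    kept : ∀ {j} → j ≤ h → select j ≡ a j
    kept {j} j≤h = ≡.cong (if_then a j else a j * q) (dec-true (j ℕ.≤? h) j≤h)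
    scaled : ∀ {j} → h < j → select j ≡ a j * q
    scaled {j} h<j = ≡.cong (if_then a j else a j * q) (dec-false (j ℕ.≤? h) (ℕ.<⇒≱ h<j))

  omit-split : ∀ a {k j xs ys} → idx k ≡ xs ++ j ∷ ys → All (_≢ j) xs → All (_≢ j) ys →
               omit a k j ≡ map a (xs ++ ys)
  omit-split a {k} {j} {xs} {ys} idx≡ xs≢j ys≢j = ≡.cong (map a) (begin
    filter keep (idx k)                        ≡⟨ ≡.cong (filter keep) idx≡ ⟩
    filter keep (xs ++ j ∷ ys)                 ≡⟨ List.filter-++ keep xs (j ∷ ys) ⟩
    filter keep xs ++ filter keep (j ∷ ys)     ≡⟨ ≡.cong₂ _++_ (List.filter-all keep xs≢j)
                                                               (List.filter-reject keep (λ j≢j → j≢j ≡.refl)) ⟩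
    xs ++ filter keep ys                       ≡⟨ ≡.cong (xs ++_) (List.filter-all keep ys≢j) ⟩
    xs ++ ys                                   ∎)
    where
    keep = λ i → ¬? (i ℕ.≟ j)

data Position : ℕ → ℕ → Set where
  empty : Position 0 0
  first : ∀ c → Position 0 (suc c)
  inner : ∀ h c → Position (suc h) (suc h ℕ.+ suc c)
  last  : ∀ h → Position (suc h) (suc h)

position : ∀ {h k} → h ≤ k → Position h k
position {zero}  {zero}  _ = empty
position {zero}  {suc k} _ = first k
position {suc h} {suc k} h≤k with ℕ.m≤n⇒m<n∨m≡n (ℕ.s≤s⁻¹ h≤k)
... | inj₂ ≡.refl = last h
... | inj₁ h<k with c , ≡.refl ← ℕ.m≤n⇒∃[o]m+o≡n h<k =
  ≡.subst (Position (suc h) ∘ suc) (ℕ.+-suc h c) (inner h c)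

module Lemma2p4 {c ℓ} (F : Field c ℓ) (q : Field.Carrier F) (q≉0 : ¬ Field._≈_ F q (Field.0# F))
                (a : ℕ → Field.Carrier F) where
  open Field F
  open FieldDefs F
  open FieldProperties F
  open QChains F q q≉0 (a 0)
  open EntryLists F
  open import Relation.Binary.Reasoning.Setoid setoid

  rhs : ℕ → ℕ → ℕ → Carrier
  rhs k h n = (if h <ᵇ k then (a h * C (omit a k (suc h)) 0 n) ÷ (a h - a (suc h)) else 0#)
            + (if 0 <ᵇ h then (a (suc h) * C (omit a k h) 0 n) ÷ (a (suc h) - a h) else 0#)

  chain-entries-first : ∀ c {N} → Avoids (suc N) (entries a (suc c)) →
    C (entries a (suc c)) 0 (suc N) ≈ rhs (suc c) 0 (suc N) + C (shifted q a (suc c) 0) 0 N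
  chain-entries-first c {N} avoids = begin
    C (entries a (suc c)) 0 (suc N)
      ≡⟨ ≡.cong (λ us → C us 0 (suc N)) entries≡ ⟩
    C (a 1 ∷ R) 0 (suc N)
      ≈⟨ chain-bottom (a 1) R (≡.subst (Avoids (suc N)) entries≡ avoids) ⟩
    (a 0 ÷ (a 0 - a 1)) * C R 0 (suc N) + C (map (_* q) (a 1 ∷ R)) 0 N
      ≈⟨ +-congʳ (trans (÷-*-comm _ _ _) (sym (+-identityʳ _))) ⟩
    ((a 0 * C R 0 (suc N)) ÷ (a 0 - a 1) + 0#) + C (map (_* q) (a 1 ∷ R)) 0 N
      ≡⟨ ≡.cong₂ (λ us vs → ((a 0 * C us 0 (suc N)) ÷ (a 0 - a 1) + 0#) + C vs 0 N) omit≡ shifted≡ ⟨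
    rhs (suc c) 0 (suc N) + C (shifted q a (suc c) 0) 0 N ∎
    where
    R = map a (later 0 c)
    entries≡ : entries a (suc c) ≡ a 1 ∷ R
    entries≡ = ≡.cong (map a) (idx-split 0 c)
    shifted≡ : shifted q a (suc c) 0 ≡ map (_* q) (a 1 ∷ R)
    shifted≡ = shifted-split q a (idx-split 0 c) [] (s≤s z≤n ∷ All.map ℕ.<⇒≤ (later-bounded 0 c))
    omit≡ : omit a (suc c) 1 ≡ R
    omit≡ = omit-split a (idx-split 0 c) [] (All.map ℕ.>⇒≢ (later-bounded 0 c))

  chain-entries-inner : ∀ h c {N} → Avoids (suc N) (entries a (suc h ℕ.+ suc c)) → ¬ a (suc h) ≈ a (suc (suc h)) →
    C (entries a (suc h ℕ.+ suc c)) 0 (suc N)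
      ≈ rhs (suc h ℕ.+ suc c) (suc h) (suc N) + C (shifted q a (suc h ℕ.+ suc c) (suc h)) 0 N
  chain-entries-inner h c {N} avoids aₕ≉aₕ₊₁ = begin
    C (entries a k) 0 (suc N)
      ≡⟨ ≡.cong (λ us → C us 0 (suc N)) entries≡ ⟩
    C (P ++ aₕ ∷ aₕ₊₁ ∷ R) 0 (suc N)
      ≈⟨ chain-tie P aₕ aₕ₊₁ R avoids′ aₕ≉aₕ₊₁ ⟩
    ((aₕ ÷ (aₕ - aₕ₊₁)) * X + (aₕ₊₁ ÷ (aₕ₊₁ - aₕ)) * Y) + C (P ++ aₕ ∷ map (_* q) (aₕ₊₁ ∷ R)) 0 N
      ≈⟨ +-congʳ (+-cong (÷-*-comm _ _ _) (÷-*-comm _ _ _)) ⟩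
    ((aₕ * X) ÷ (aₕ - aₕ₊₁) + (aₕ₊₁ * Y) ÷ (aₕ₊₁ - aₕ)) + C (P ++ aₕ ∷ map (_* q) (aₕ₊₁ ∷ R)) 0 N
      ≡⟨ ≡.cong₂ _+_ rhs≡ (≡.cong (λ us → C us 0 N) shifted≡) ⟨
    rhs k (suc h) (suc N) + C (shifted q a k (suc h)) 0 N ∎
    where
    k = suc h ℕ.+ suc c
    aₕ = a (suc h)
    aₕ₊₁ = a (suc (suc h))
    P = map a (idx h)
    R = map a (later (suc h) c)
    X = C (P ++ aₕ ∷ R) 0 (suc N)
    Y = C (P ++ aₕ₊₁ ∷ R) 0 (suc N)
    idx≡ : idx k ≡ idx h ++ suc h ∷ suc (suc h) ∷ later (suc h) c
    idx≡ = ≡.trans (idx-split (suc h) c)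
             (≡.trans (≡.cong (_++ suc (suc h) ∷ later (suc h) c) (idx-suc h)) (List.++-assoc (idx h) _ _))
    entries≡ : entries a k ≡ P ++ aₕ ∷ aₕ₊₁ ∷ R
    entries≡ = ≡.trans (≡.cong (map a) idx≡) (List.map-++ a (idx h) _)
    avoids′ : Avoids (suc N) (aₕ ∷ aₕ₊₁ ∷ R)
    avoids′ m m≤ = All.++⁻ʳ P (≡.subst (All _) entries≡ (avoids m m≤))
    prefix≡ : map a (idx (suc h)) ≡ P ++ aₕ ∷ []
    prefix≡ = ≡.trans (≡.cong (map a) (idx-suc h)) (List.map-++ a (idx h) _)
    shifted≡ : shifted q a k (suc h) ≡ P ++ aₕ ∷ map (_* q) (aₕ₊₁ ∷ R)
    shifted≡ = ≡.trans
      (shifted-split q a (idx-split (suc h) c) (idx-bounded (suc h))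
         (ℕ.n<1+n (suc h) ∷ All.map (ℕ.<-trans (ℕ.n<1+n (suc h))) (later-bounded (suc h) c)))
      (≡.trans (≡.cong (_++ map (_* q) (aₕ₊₁ ∷ R)) prefix≡) (List.++-assoc P _ _))
    omit≡ : omit a k (suc h) ≡ P ++ aₕ₊₁ ∷ R
    omit≡ = ≡.trans
      (omit-split a idx≡ (All.map (ℕ.<⇒≢ ∘ s≤s) (idx-bounded h))
         (ℕ.>⇒≢ (ℕ.n<1+n (suc h)) ∷ All.map (ℕ.>⇒≢ ∘ ℕ.<-trans (ℕ.n<1+n (suc h))) (later-bounded (suc h) c)))
      (List.map-++ a (idx h) _)
    omit≡′ : omit a k (suc (suc h)) ≡ P ++ aₕ ∷ R
    omit≡′ = ≡.trans
      (omit-split a (idx-split (suc h) c) (All.map (ℕ.<⇒≢ ∘ s≤s) (idx-bounded (suc h)))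
         (All.map ℕ.>⇒≢ (later-bounded (suc h) c)))
      (≡.trans (List.map-++ a (idx (suc h)) _) (≡.trans (≡.cong (_++ R) prefix≡) (List.++-assoc P _ R)))
    rhs≡ : rhs k (suc h) (suc N) ≡ (aₕ * X) ÷ (aₕ - aₕ₊₁) + (aₕ₊₁ * Y) ÷ (aₕ₊₁ - aₕ)
    rhs≡ = ≡.cong₂ _+_
      (≡.cong₂ (λ b us → if b then (aₕ * C us 0 (suc N)) ÷ (aₕ - aₕ₊₁) else 0#)
               (dec-true (suc h ℕ.<? k) (ℕ.m<m+n (suc h) z<s)) omit≡′)
      (≡.cong (λ us → (aₕ₊₁ * C us 0 (suc N)) ÷ (aₕ₊₁ - aₕ)) omit≡)

  chain-entries-last : ∀ h {N} → a (suc (suc h)) ≈ point (suc N) →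
    C (entries a (suc h)) 0 (suc N) ≈ rhs (suc h) (suc h) (suc N) + C (shifted q a (suc h) (suc h)) 0 N
  chain-entries-last h {N} endpoint = begin
    C (entries a (suc h)) 0 (suc N)
      ≡⟨ ≡.cong (λ us → C us 0 (suc N)) entries≡ ⟩
    C (P ++ aₕ ∷ []) 0 (suc N)
      ≈⟨ chain-last P aₕ ⟩
    factor aₕ (suc N) * C P 0 (suc N) + C (P ++ aₕ ∷ []) 0 N
      ≈⟨ +-congʳ (trans (*-congʳ factor≈) (trans (÷-*-comm _ _ _) (sym (+-identityˡ _)))) ⟩
    (0# + (aₕ₊₁ * C P 0 (suc N)) ÷ (aₕ₊₁ - aₕ)) + C (P ++ aₕ ∷ []) 0 N
      ≡⟨ ≡.cong₂ _+_ rhs≡ (≡.cong (λ us → C us 0 N) (≡.trans shifted≡ entries≡)) ⟨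
    rhs (suc h) (suc h) (suc N) + C (shifted q a (suc h) (suc h)) 0 N ∎
    where
    aₕ = a (suc h)
    aₕ₊₁ = a (suc (suc h))
    P = map a (idx h)
    entries≡ : entries a (suc h) ≡ P ++ aₕ ∷ []
    entries≡ = ≡.trans (≡.cong (map a) (idx-suc h)) (List.map-++ a (idx h) _)
    shifted≡ : shifted q a (suc h) (suc h) ≡ entries a (suc h)
    shifted≡ = ≡.trans (shifted-split q a (≡.sym (List.++-identityʳ _)) (idx-bounded (suc h)) []) (List.++-identityʳ _)
    omit≡ : omit a (suc h) (suc h) ≡ P
    omit≡ = ≡.trans (omit-split a (idx-suc h) (All.map (ℕ.<⇒≢ ∘ s≤s) (idx-bounded h)) [])
                    (≡.cong (map a) (List.++-identityʳ _))
    factor≈ : factor aₕ (suc N) ≈ aₕ₊₁ ÷ (aₕ₊₁ - aₕ)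
    factor≈ = *-cong (sym endpoint) (inv-cong (+-congʳ (sym endpoint)))
    rhs≡ : rhs (suc h) (suc h) (suc N) ≡ 0# + (aₕ₊₁ * C P 0 (suc N)) ÷ (aₕ₊₁ - aₕ)
    rhs≡ = ≡.cong₂ _+_
      (≡.cong (if_then (aₕ * C (omit a (suc h) (suc (suc h))) 0 (suc N)) ÷ (aₕ - aₕ₊₁) else 0#)
              (dec-false (suc h ℕ.<? suc h) (ℕ.<-irrefl ≡.refl)))
      (≡.cong (λ us → (aₕ₊₁ * C us 0 (suc N)) ÷ (aₕ₊₁ - aₕ)) omit≡)

  chain-entries : ∀ {h k N} → Position h k → Avoids (suc N) (entries a k) → ¬ a h ≈ a (suc h) →
                  a (suc k) ≈ point (suc N) →
                  C (entries a k) 0 (suc N) ≈ rhs k h (suc N) + C (shifted q a k h) 0 N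
  chain-entries empty       _      _   _        = sym (trans (+-congʳ (+-identityʳ 0#)) (+-identityˡ 1#))
  chain-entries (first c)   avoids _   _        = chain-entries-first c avoids
  chain-entries (inner h c) avoids a≉ _        = chain-entries-inner h c avoids a≉
  chain-entries (last h)    _      _   endpoint = chain-entries-last h endpoint

-- Unused: a_{k+1} ≉ 0, d₃, d₄ and all of d₂ except its exponent; they are consequences of d₁.
lemma2p4 : ∀ {c ℓ} (F : Field c ℓ) → let open Field F in let open FieldDefs F in
    (q : Carrier) → ¬ (q ≈ 0#) → (∀ (N : ℕ) → ¬ (pow q (suc N) ≈ 1#)) →
    (k h : ℕ) → h ≤ k →
    (a : ℕ → Carrier) → ¬ (a 0 ≈ 0#) → ¬ (a (suc k) ≈ 0#) →
    ¬ (a h ≈ a (suc h)) →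
    (d₁ : Defined q (a 0) (entries a k) (a (suc k))) →
    (d₂ : Defined q (a 0) (shifted q a k h) (a (suc k) * q)) →
    (h < k → Defined q (a 0) (omit a k (suc h)) (a (suc k))) →
    (0 < h → Defined q (a 0) (omit a k h) (a (suc k))) →
    let p₁ = proj₁ (proj₂ (proj₂ d₁)) in
    Iq q (a 0) (entries a k) (a (suc k)) p₁
      - Iq q (a 0) (shifted q a k h) (a (suc k) * q) (proj₁ (proj₂ (proj₂ d₂)))
    ≈ (if h <ᵇ k
         then (a h * Iq q (a 0) (omit a k (suc h)) (a (suc k)) p₁) ÷ (a h - a (suc h))
         else 0#)
      + (if 0 <ᵇ h
           then (a (suc h) * Iq q (a 0) (omit a k h) (a (suc k)) p₁) ÷ (a (suc h) - a h)
           else 0#)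
lemma2p4 F q q≉0 aperiodic k h h≤k a a₀≉0 _ aₕ≉aₕ₊₁ (_ , _ , (n , y≈) , avoid) (_ , _ , (N , yq≈) , _) _ _
  with ≡.refl ← QChains.exponent-suc F q q≉0 (a 0) a₀≉0 aperiodic {n = n} {N} y≈ yq≈ =
  trans (+-congʳ (chain-entries (position h≤k) (avoids-between {n = suc N} y≈ avoid) aₕ≉aₕ₊₁ y≈))
        (//-rightDividesʳ _ _)
  where
  open Field F
  open QChains F q q≉0 (a 0)
  open Lemma2p4 F q q≉0 a
  open import Algebra.Properties.Group +-group using (//-rightDividesʳ)
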